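{- Let $(\mathcal{H},\mathcal{M})$ be a simply matroid-rooted mixed hypergraph with $\mathcal{H}=(V\cup R,\mathcal{A}\cup\mathcal{E})$ and $\mathcal{M}=(R,r_{\mathcal{M}})$, and let $b(\mathcal{X})=r_{\mathcal{M}}(R)(|V_{\mathcal{X}}|-1)+r_{\mathcal{M}}(R_{\mathcal{X}})$ for $\mathcal{X}\subseteq\mathcal{A}\cup\mathcal{E}$. Then $$\mathcal{I}=\{\mathcal{X}\subseteq\mathcal{A}\cup\mathcal{E}: b(\mathcal{Y})\ge|\mathcal{Y}|\text{ for all nonempty }\mathcal{Y}\subseteq\mathcal{X}\}$$ is the family of independent sets of a matroid on $\mathcal{A}\cup\mathcal{E}$.
   Context: A mixed hypergraph $(W,\mathcal{A}\cup\mathcal{E})$ has a finite vertex set $W$, a finite set $\mathcal{A}$ of dyperedges (pairs $(tail(a),head(a))$ with $head(a)\in W$ and $\emptyset\ne tail(a)\subseteq W-head(a)$) and a finite set $\mathcal{E}$ of hyperedges (subsets of $W$ of size at least $2$). A dyperedge enters $X$ if its head is in $X$ and its tail meets $W-X$; it leaves $X$ if it enters $W-X$; a hyperedge enters $X$ if it meets $X$ and $W-X$. A vertex $r$ is a simple root if no dyperedge or hyperedge enters $\{r\}$, every dyperedge leaving $\{r\}$ has tail $\{r\}$, and at most one dyperedge leaves $\{r\}$. A simply matroid-rooted mixed hypergraph is $(\mathcal{H},\mathcal{M})$ with $\mathcal{H}=(V\cup R,\mathcal{A}\cup\mathcal{E})$, $V\cap R=\emptyset$, every vertex of $R$ a simple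 root, and $\mathcal{M}$ a matroid on $R$ with rank function $r_{\mathcal{M}}$. For $\mathcal{Z}\subseteq\mathcal{A}\cup\mathcal{E}$, $V_{\mathcal{Z}}$ is the set of vertices of $V$ incident to at least one element of $\mathcal{Z}$, and $R_{\mathcal{Z}}$ is the set of vertices of $R$ incident to at least one dyperedge of $\mathcal{Z}$. (This matroid is called the Tanigawa matroid $\mathcal{T}_{(\mathcal{H},\mathcal{M})}$.) -}

module Defs where

open import Data.Nat using (ℕ; zero; suc; _+_; _*_; _∸_; _≤_; _<_)
open import Data.Bool using (Bool; true; false; _∧_; _∨_; not)
open import Data.Fin using (Fin; zero; suc)
open import Data.Fin.Subset using (Subset; _∈_; _∉_; _⊆_; ∣_∣; Nonempty; ⁅_⁆; ∁; _∪_; _∩_; ⊥)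
open import Data.Vec using (Vec; lookup; tabulate)
open import Data.Sum using (_⊎_; inj₁; inj₂)
open import Data.Product using (Σ; ∃; _×_; _,_; proj₁; proj₂)
open import Relation.Binary.PropositionalEquality using (_≡_)
open import Relation.Nullary using (¬_)
import Data.Empty as E

record IsMatroidRank {n : ℕ} (r : Subset n → ℕ) : Set where
  field
    bounded    : ∀ X → r X ≤ ∣ X ∣
    monotone   : ∀ X Y → X ⊆ Y → r X ≤ r Y
    submodular : ∀ X Y → r (X ∪ Y) + r (X ∩ Y) ≤ r X + r Y

record IsMatroidIndependence {n : ℕ} (I : Subset n → Set) : Set where
  field
    empty-indep  : I ⊥
    down-closed  : ∀ X Y → Y ⊆ X → I X → I Y
    augmentation : ∀ X Y → I X → I Y → ∣ X ∣ < ∣ Y ∣ →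
                   Σ (Fin n) λ e → e ∈ Y × e ∉ X × I (⁅ e ⁆ ∪ X)

-- Mixed hypergraphs with vertex set W = V ⊎ R, V = Fin p, R = Fin k.

Vtx : ℕ → ℕ → Set
Vtx p k = Fin p ⊎ Fin k

VSet : ℕ → ℕ → Set
VSet p k = Subset p × Subset k

memB : ∀ {p k} → Vtx p k → VSet p k → Bool
memB (inj₁ v) S = lookup (proj₁ S) v
memB (inj₂ r) S = lookup (proj₂ S) r

_∈W_ : ∀ {p k} → Vtx p k → VSet p k → Set
w ∈W S = memB w S ≡ true

_∉W_ : ∀ {p k} → Vtx p k → VSet p k → Set
w ∉W S = memB w S ≡ false

compW : ∀ {p k} → VSet p k → VSet p k
compW (A , B) = ∁ A , ∁ B

sizeW : ∀ {p k} → VSet p k → ℕ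
sizeW (A , B) = ∣ A ∣ + ∣ B ∣

singletonR : ∀ {p k} → Fin k → VSet p k
singletonR r = ⊥ , ⁅ r ⁆

-- an element of A ∪ E: a dyperedge (tail , head) or a hyperedge
data Edge (p k : ℕ) : Set where
  dyp : VSet p k → Vtx p k → Edge p k
  hyp : VSet p k → Edge p k

WellFormed : ∀ {p k} → Edge p k → Set
WellFormed (dyp t h) = (Σ _ λ w → w ∈W t) × h ∉W t
WellFormed (hyp S)   = 2 ≤ sizeW S

Enters : ∀ {p k} → Edge p k → VSet p k → Set
Enters (dyp t h) X = h ∈W X × Σ _ λ w → w ∈W t × w ∉W X
Enters (hyp S)   X = (Σ _ λ w → w ∈W S × w ∈W X) × (Σ _ λ w → w ∈W S × w ∉W X)

Leaves : ∀ {p k} → Edge p k → VSet p k → Set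
Leaves (dyp t h) X = Enters (dyp t h) (compW X)
Leaves (hyp S)   X = E.⊥

TailIs : ∀ {p k} → Edge p k → VSet p k → Set
TailIs (dyp t h) S = t ≡ S
TailIs (hyp _)   S = E.⊥

IsSimpleRoot : ∀ {p k m} → (Fin m → Edge p k) → Fin k → Set
IsSimpleRoot e r =
  (∀ i → ¬ Enters (e i) (singletonR r)) ×
  (∀ i → Leaves (e i) (singletonR r) → TailIs (e i) (singletonR r)) ×
  (∀ i j → Leaves (e i) (singletonR r) → Leaves (e j) (singletonR r) → i ≡ j)

incident : ∀ {p k} → Edge p k → Vtx p k → Bool
incident (dyp t h) w = memB w t ∨ memB w (headSet h)
  where
  headSet : _ → VSet _ _
  headSet (inj₁ v) = ⁅ v ⁆ , ⊥
  headSet (inj₂ r) = ⊥ , ⁅ r ⁆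
incident (hyp S) w = memB w S

isDyp : ∀ {p k} → Edge p k → Bool
isDyp (dyp _ _) = true
isDyp (hyp _)   = false

anyFin : ∀ {m} → (Fin m → Bool) → Bool
anyFin {zero}  f = false
anyFin {suc m} f = f zero ∨ anyFin (λ i → f (suc i))

V[_] : ∀ {p k m} → (Fin m → Edge p k) → Subset m → Subset p
V[ e ] Z = tabulate λ v → anyFin λ i → lookup Z i ∧ incident (e i) (inj₁ v)

R[_] : ∀ {p k m} → (Fin m → Edge p k) → Subset m → Subset k
R[ e ] Z = tabulate λ r → anyFin λ i → lookup Z i ∧ (isDyp (e i) ∧ incident (e i) (inj₂ r))

bfun : ∀ {p k m} → (Fin m → Edge p k) → (Subset k → ℕ) → Subset m → ℕ
bfun e rM X = rM Data.Fin.Subset.⊤ * (∣ V[ e ] X ∣ ∸ 1) + rM (R[ e ] X)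
  where import Data.Fin.Subset

Indep : ∀ {p k m} → (Fin m → Edge p k) → (Subset k → ℕ) → Subset m → Set
Indep e rM X = ∀ Y → Y ⊆ X → Nonempty Y → ∣ Y ∣ ≤ bfun e rM Y

-- The function b is monotone and intersecting submodular: nothing enters a root, so every
-- element of A ∪ E meets V and |V_X| ≥ 1 for nonempty X, which makes r(R)(|V_X| − 1)
-- submodular on intersecting pairs, while X ↦ r(R_X) is submodular because r is.
-- For any such f the f-sparse sets form a matroid. Given sparse X, Y with |X| < |Y| and no
-- e ∈ Y − X extending X, each e ∈ Y − X lies in a set S that is tight for X
-- (f(S) = |S ∩ X|). Intersecting tight sets have tight unions, so the greatest tight sets
-- through the elements of Y − X are pairwise disjoint or equal; on each of them
-- |S ∩ Y| ≤ f(S) = |S ∩ X|, and summing gives |Y| ≤ |X|.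
module Submission where

open import Defs
import Algebra.Properties.IdempotentCommutativeMonoid as IdempotentCommutativeMonoid
open import Data.Bool using (Bool; true; false; _∧_; _∨_)
open import Data.Bool.Properties using (∨-zeroʳ; ¬-not)
open import Data.Empty using (⊥-elim)
open import Data.Fin using (Fin; zero; suc) renaming (_≟_ to _≟ᶠ_)
open import Data.Fin.Properties using (any?)
open import Data.Fin.Subset
open import Data.Fin.Subset.Induction using (⊂-wellFounded; ⊃-wellFounded)
open import Data.Fin.Subset.Properties
open import Data.Nat using (ℕ; zero; suc; _+_; _*_; _∸_; _≤_; _<_; z≤n; s≤s)
open import Data.Nat.Properties
open import Algebra.Properties.CommutativeSemigroup +-commutativeSemigroup using (interchange)
open import Data.Product using (∃; _×_; _,_; proj₁; proj₂)
open import Data.Sum using (inj₁; inj₂)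
open import Function using (_∘_)
open import Data.Vec using (_∷_; []; there; lookup; tabulate)
open import Data.Vec.Properties using ([]=⇒lookup; lookup⇒[]=; lookup∘tabulate; lookup-replicate)
open import Induction.WellFounded using (Acc; acc)
open import Relation.Nullary using (¬_; Dec; yes; no)
open import Relation.Nullary.Decidable using (_×-dec_; ¬?; map′)
open import Relation.Binary.PropositionalEquality

∣p∪q∣+∣p∩q∣≡∣p∣+∣q∣ : ∀ {n} (p q : Subset n) → ∣ p ∪ q ∣ + ∣ p ∩ q ∣ ≡ ∣ p ∣ + ∣ q ∣
∣p∪q∣+∣p∩q∣≡∣p∣+∣q∣ []          []          = refl
∣p∪q∣+∣p∩q∣≡∣p∣+∣q∣ (true  ∷ p) (true  ∷ q) =
  cong suc (trans (+-suc _ _) (trans (cong suc (∣p∪q∣+∣p∩q∣≡∣p∣+∣q∣ p q)) (sym (+-suc _ _))))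
∣p∪q∣+∣p∩q∣≡∣p∣+∣q∣ (true  ∷ p) (false ∷ q) = cong suc (∣p∪q∣+∣p∩q∣≡∣p∣+∣q∣ p q)
∣p∪q∣+∣p∩q∣≡∣p∣+∣q∣ (false ∷ p) (true  ∷ q) =
  trans (cong suc (∣p∪q∣+∣p∩q∣≡∣p∣+∣q∣ p q)) (sym (+-suc _ _))
∣p∪q∣+∣p∩q∣≡∣p∣+∣q∣ (false ∷ p) (false ∷ q) = ∣p∪q∣+∣p∩q∣≡∣p∣+∣q∣ p q

∣p∪q∩r∣+∣p∩q∩r∣≡∣p∩r∣+∣q∩r∣ : ∀ {n} (p q r : Subset n) →
                              ∣ (p ∪ q) ∩ r ∣ + ∣ (p ∩ q) ∩ r ∣ ≡ ∣ p ∩ r ∣ + ∣ q ∩ r ∣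
∣p∪q∩r∣+∣p∩q∩r∣≡∣p∩r∣+∣q∩r∣ {n} p q r = begin
  ∣ (p ∪ q) ∩ r ∣ + ∣ (p ∩ q) ∩ r ∣
    ≡⟨ cong₂ (λ a b → ∣ a ∣ + ∣ b ∣) (∩-distribʳ-∪ r p q) (∩-distribʳ-∩ r p q) ⟩
  ∣ (p ∩ r) ∪ (q ∩ r) ∣ + ∣ (p ∩ r) ∩ (q ∩ r) ∣
    ≡⟨ ∣p∪q∣+∣p∩q∣≡∣p∣+∣q∣ (p ∩ r) (q ∩ r) ⟩
  ∣ p ∩ r ∣ + ∣ q ∩ r ∣ ∎
  where
  open ≡-Reasoning
  open IdempotentCommutativeMonoid (∩-idempotentCommutativeMonoid n)
    renaming (∙-distrʳ-∙ to ∩-distribʳ-∩)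

∣p∩q∣+∣p∩∁q∣≡∣p∣ : ∀ {n} (p q : Subset n) → ∣ p ∩ q ∣ + ∣ p ∩ ∁ q ∣ ≡ ∣ p ∣
∣p∩q∣+∣p∩∁q∣≡∣p∣ []          []          = refl
∣p∩q∣+∣p∩∁q∣≡∣p∣ (true  ∷ p) (true  ∷ q) = cong suc (∣p∩q∣+∣p∩∁q∣≡∣p∣ p q)
∣p∩q∣+∣p∩∁q∣≡∣p∣ (true  ∷ p) (false ∷ q) = trans (+-suc _ _) (cong suc (∣p∩q∣+∣p∩∁q∣≡∣p∣ p q))
∣p∩q∣+∣p∩∁q∣≡∣p∣ (false ∷ p) (true  ∷ q) = ∣p∩q∣+∣p∩∁q∣≡∣p∣ p q
∣p∩q∣+∣p∩∁q∣≡∣p∣ (false ∷ p) (false ∷ q) = ∣p∩q∣+∣p∩∁q∣≡∣p∣ p q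

Empty⇒∣p∣≡0 : ∀ {n} {p : Subset n} → Empty p → ∣ p ∣ ≡ 0
Empty⇒∣p∣≡0 {n} p-empty = trans (cong ∣_∣ (Empty-unique p-empty)) (∣⊥∣≡0 n)

x∈p⇒1≤∣p∣ : ∀ {n} {x : Fin n} {p : Subset n} → x ∈ p → 1 ≤ ∣ p ∣
x∈p⇒1≤∣p∣ x∈p = ≤-trans (s≤s z≤n) (x∈p⇒∣p-x∣<∣p∣ x∈p)

x∈p─q⇒x∉q : ∀ {n} {x : Fin n} (p q : Subset n) → x ∈ p ─ q → x ∉ q
x∈p─q⇒x∉q (_ ∷ p) (true  ∷ q) (there x∈p─q) (there x∈q) = x∈p─q⇒x∉q p q x∈p─q x∈q
x∈p─q⇒x∉q (_ ∷ p) (false ∷ q) (there x∈p─q) (there x∈q) = x∈p─q⇒x∉q p q x∈p─q x∈q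

∣p∩r∣≤∣q∩r∣⇒∣p∣≤∣q∣ : ∀ {n} (p q r : Subset n) → p ─ q ⊆ r →
                      ∣ p ∩ r ∣ ≤ ∣ q ∩ r ∣ → ∣ p ∣ ≤ ∣ q ∣
∣p∩r∣≤∣q∩r∣⇒∣p∣≤∣q∣ p q r p─q⊆r on-r = begin
  ∣ p ∣                     ≡⟨ ∣p∩q∣+∣p∩∁q∣≡∣p∣ p r ⟨
  ∣ p ∩ r ∣ + ∣ p ∩ ∁ r ∣  ≤⟨ +-mono-≤ on-r (p⊆q⇒∣p∣≤∣q∣ off-r) ⟩
  ∣ q ∩ r ∣ + ∣ q ∩ ∁ r ∣  ≡⟨ ∣p∩q∣+∣p∩∁q∣≡∣p∣ q r ⟩
  ∣ q ∣                     ∎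
  where
  open ≤-Reasoning
  off-r : p ∩ ∁ r ⊆ q ∩ ∁ r
  off-r {x} x∈p∩∁r with x∈p∩q⁻ p (∁ r) x∈p∩∁r | x ∈? q
  ... | _ , x∈∁r | yes x∈q = x∈p∩q⁺ (x∈q , x∈∁r)
  ... | x∈p , x∈∁r | no x∉q = ⊥-elim (x∈∁p⇒x∉p x∈∁r (p─q⊆r (x∈p∧x∉q⇒x∈p─q x∈p x∉q)))

Greatest : ∀ {n} → (Subset n → Set) → Subset n → Set
Greatest Q M = Q M × (∀ {S} → Q S → S ⊆ M)

greatest : ∀ {n} {Q : Subset n → Set} → (∀ S → Dec (Q S)) →
           (∀ {S T} → Q S → Q T → Q (S ∪ T)) → ∀ {S} → Q S → ∃ (Greatest Q)
greatest {Q = Q} Q? ∪-closed {S} QS = grow S QS (⊃-wellFounded S)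
  where
  grow : ∀ S → Q S → Acc _⊃_ S → ∃ (Greatest Q)
  grow S QS (acc larger) with anySubset? (λ T → Q? T ×-dec (S ⊂? S ∪ T))
  ... | yes (T , QT , S⊂S∪T) = grow (S ∪ T) (∪-closed QS QT) (larger S⊂S∪T)
  ... | no none = S , QS , bounded
    where
    bounded : ∀ {T} → Q T → T ⊆ S
    bounded {T} QT {x} x∈T with x ∈? S
    ... | yes x∈S = x∈S
    ... | no x∉S = ⊥-elim (none (T , QT , p⊆p∪q T , x , x∈p∪q⁺ (inj₂ x∈T) , x∉S))

module SparseMatroid {m : ℕ} (f : Subset m → ℕ)
  (f-mono : ∀ {X Y} → X ⊆ Y → f X ≤ f Y)
  (f-intersecting-submodular : ∀ X Y → Nonempty (X ∩ Y) → f (X ∪ Y) + f (X ∩ Y) ≤ f X + f Y) where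

  Sparse : Subset m → Set
  Sparse X = ∀ Y → Y ⊆ X → Nonempty Y → ∣ Y ∣ ≤ f Y

  Violates : Subset m → Subset m → Set
  Violates X Z = Z ⊆ X × Nonempty Z × f Z < ∣ Z ∣

  violation? : ∀ X → Dec (∃ (Violates X))
  violation? X = anySubset? (λ Z → (Z ⊆? X) ×-dec (nonempty? Z ×-dec (f Z <? ∣ Z ∣)))

  ¬violation⇒sparse : ∀ {X} → ¬ ∃ (Violates X) → Sparse X
  ¬violation⇒sparse none Y Y⊆X Y≢∅ = ≮⇒≥ (λ f<∣Y∣ → none (Y , Y⊆X , Y≢∅ , f<∣Y∣))

  sparse⇒¬violation : ∀ {X} → Sparse X → ¬ ∃ (Violates X)
  sparse⇒¬violation X-sparse (Z , Z⊆X , Z≢∅ , f<∣Z∣) = <⇒≱ f<∣Z∣ (X-sparse Z Z⊆X Z≢∅)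

  sparse? : ∀ X → Dec (Sparse X)
  sparse? X = map′ ¬violation⇒sparse sparse⇒¬violation (¬? (violation? X))

  ¬sparse⇒violation : ∀ {X} → ¬ Sparse X → ∃ (Violates X)
  ¬sparse⇒violation {X} ¬sparse with violation? X
  ... | yes violation = violation
  ... | no none = ⊥-elim (¬sparse (¬violation⇒sparse none))

  sparse⇒∣∩∣≤f : ∀ {W} → Sparse W → ∀ C → ∣ C ∩ W ∣ ≤ f C
  sparse⇒∣∩∣≤f {W} W-sparse C with nonempty? (C ∩ W)
  ... | yes C∩W≢∅ = ≤-trans (W-sparse (C ∩ W) (p∩q⊆q C W) C∩W≢∅) (f-mono (p∩q⊆p C W))
  ... | no C∩W≡∅ = ≤-trans (≤-reflexive (Empty⇒∣p∣≡0 C∩W≡∅)) z≤n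

  module Augmentation {X Y : Subset m} (X-sparse : Sparse X) (Y-sparse : Sparse Y) where

    -- Since X is sparse, f S ≥ ∣ S ∩ X ∣ always, so a tight S has f S = ∣ S ∩ X ∣.
    Tight : Subset m → Set
    Tight S = Nonempty S × f S ≤ ∣ S ∩ X ∣

    tight? : ∀ S → Dec (Tight S)
    tight? S = nonempty? S ×-dec (f S ≤? ∣ S ∩ X ∣)

    tight-∪ : ∀ {S T} → Tight S → Tight T → Nonempty (S ∩ T) → Tight (S ∪ T)
    tight-∪ {S} {T} ((x , x∈S) , fS≤) (_ , fT≤) S∩T≢∅ =
      (x , p⊆p∪q T x∈S) ,
      +-cancelʳ-≤ (f (S ∩ T)) (f (S ∪ T)) ∣ (S ∪ T) ∩ X ∣ (begin
        f (S ∪ T) + f (S ∩ T)              ≤⟨ f-intersecting-submodular S T S∩T≢∅ ⟩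
        f S + f T                          ≤⟨ +-mono-≤ fS≤ fT≤ ⟩
        ∣ S ∩ X ∣ + ∣ T ∩ X ∣              ≡⟨ ∣p∪q∩r∣+∣p∩q∩r∣≡∣p∩r∣+∣q∩r∣ S T X ⟨
        ∣ (S ∪ T) ∩ X ∣ + ∣ (S ∩ T) ∩ X ∣  ≤⟨ +-monoʳ-≤ _ (sparse⇒∣∩∣≤f X-sparse (S ∩ T)) ⟩
        ∣ (S ∪ T) ∩ X ∣ + f (S ∩ T)        ∎)
      where open ≤-Reasoning

    tight⇒∣∩Y∣≤∣∩X∣ : ∀ {S} → Tight S → ∣ S ∩ Y ∣ ≤ ∣ S ∩ X ∣
    tight⇒∣∩Y∣≤∣∩X∣ {S} (_ , fS≤) = ≤-trans (sparse⇒∣∩∣≤f Y-sparse S) fS≤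

    Through : Fin m → Subset m → Set
    Through e S = Tight S × e ∈ S

    violation⇒through : ∀ {e Z} → Violates (⁅ e ⁆ ∪ X) Z → Through e Z
    violation⇒through {e} {Z} (Z⊆e+X , Z≢∅ , f<∣Z∣) = (Z≢∅ , fZ≤) , e∈Z
      where
      Z─e⊆X : ∀ {x} → x ∈ Z → x ∉ ⁅ e ⁆ → x ∈ X
      Z─e⊆X x∈Z x∉e with x∈p∪q⁻ ⁅ e ⁆ X (Z⊆e+X x∈Z)
      ... | inj₁ x∈e = ⊥-elim (x∉e x∈e)
      ... | inj₂ x∈X = x∈X

      e∈Z : e ∈ Z
      e∈Z with e ∈? Z
      ... | yes e∈Z = e∈Z
      ... | no e∉Z = ⊥-elim (<⇒≱ f<∣Z∣ (X-sparse Z Z⊆X Z≢∅))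
        where
        Z⊆X : Z ⊆ X
        Z⊆X x∈Z = Z─e⊆X x∈Z (λ x∈e → e∉Z (subst (_∈ Z) (x∈⁅y⁆⇒x≡y e x∈e) x∈Z))

      Z∩∁X⊆e : Z ∩ ∁ X ⊆ ⁅ e ⁆
      Z∩∁X⊆e {x} x∈Z∩∁X with x∈p∩q⁻ Z (∁ X) x∈Z∩∁X | x ∈? ⁅ e ⁆
      ... | _ , _ | yes x∈e = x∈e
      ... | x∈Z , x∈∁X | no x∉e = ⊥-elim (x∈∁p⇒x∉p x∈∁X (Z─e⊆X x∈Z x∉e))

      fZ≤ : f Z ≤ ∣ Z ∩ X ∣
      fZ≤ = ≤-pred (begin
        suc (f Z)                  ≤⟨ f<∣Z∣ ⟩
        ∣ Z ∣                      ≡⟨ ∣p∩q∣+∣p∩∁q∣≡∣p∣ Z X ⟨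
        ∣ Z ∩ X ∣ + ∣ Z ∩ ∁ X ∣    ≤⟨ +-monoʳ-≤ _ (p⊆q⇒∣p∣≤∣q∣ Z∩∁X⊆e) ⟩
        ∣ Z ∩ X ∣ + ∣ ⁅ e ⁆ ∣      ≡⟨ cong (∣ Z ∩ X ∣ +_) (∣⁅x⁆∣≡1 e) ⟩
        ∣ Z ∩ X ∣ + 1              ≡⟨ +-comm _ 1 ⟩
        suc ∣ Z ∩ X ∣              ∎)
        where open ≤-Reasoning

    module _ (tight-through : ∀ {e} → e ∈ Y ─ X → ∃ (Through e)) where

      greatest-through : ∀ {e} → e ∈ Y ─ X → ∃ (Greatest (Through e))
      greatest-through {e} e∈Y─X =
        greatest (λ S → tight? S ×-dec (e ∈? S)) ∪-through (proj₂ (tight-through e∈Y─X))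
        where
        ∪-through : ∀ {S T} → Through e S → Through e T → Through e (S ∪ T)
        ∪-through {S} {T} (S-tight , e∈S) (T-tight , e∈T) =
          tight-∪ S-tight T-tight (e , x∈p∩q⁺ (e∈S , e∈T)) , p⊆p∪q T e∈S

      record TightCover (D : Subset m) : Set where
        field
          U        : Subset m
          covers   : D ⊆ U
          balanced : ∣ U ∩ Y ∣ ≤ ∣ U ∩ X ∣
          by-tight : ∀ {x} → x ∈ U → ∃ λ S → Tight S × x ∈ S × Nonempty (S ∩ D)

      empty-cover : ∀ {D} → Empty D → TightCover D
      empty-cover D≡∅ = record
        { U        = ⊥
        ; covers   = λ x∈D → ⊥-elim (D≡∅ (_ , x∈D))
        ; balanced = ≤-trans (∣p∩q∣≤∣p∣ ⊥ Y) (≤-trans (≤-reflexive (∣⊥∣≡0 m)) z≤n)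
        ; by-tight = λ x∈⊥ → ⊥-elim (∉⊥ x∈⊥)
        }

      -- The greatest tight set T through e absorbs every tight set meeting it, so it is
      -- disjoint from a cover of D ─ T.
      extend-cover : ∀ {D e T} → e ∈ D → Greatest (Through e) T → TightCover (D ─ T) →
                     TightCover D
      extend-cover {D} {e} {T} e∈D ((T-tight , e∈T) , T-greatest) rest = record
        { U        = T ∪ U
        ; covers   = D⊆T∪U
        ; balanced = begin
            ∣ (T ∪ U) ∩ Y ∣        ≡⟨ ∣disjoint-∪∩∣ Y ⟩
            ∣ T ∩ Y ∣ + ∣ U ∩ Y ∣  ≤⟨ +-mono-≤ (tight⇒∣∩Y∣≤∣∩X∣ T-tight) balanced ⟩
            ∣ T ∩ X ∣ + ∣ U ∩ X ∣  ≡⟨ ∣disjoint-∪∩∣ X ⟨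
            ∣ (T ∪ U) ∩ X ∣        ∎
        ; by-tight = T∪U-by-tight
        }
        where
        open TightCover rest
        open ≤-Reasoning

        T∩U≡∅ : Empty (T ∩ U)
        T∩U≡∅ (x , x∈T∩U) with x∈p∩q⁻ T U x∈T∩U
        ... | x∈T , x∈U with by-tight x∈U
        ... | S , S-tight , x∈S , (e′ , e′∈S∩D─T) with x∈p∩q⁻ S (D ─ T) e′∈S∩D─T
        ... | e′∈S , e′∈D─T =
          x∈p─q⇒x∉q D T e′∈D─T (T-greatest T∪S-through (q⊆p∪q T S e′∈S))
          where
          T∪S-through : Through e (T ∪ S)
          T∪S-through = tight-∪ T-tight S-tight (x , x∈p∩q⁺ (x∈T , x∈S)) , p⊆p∪q S e∈T

        ∣disjoint-∪∩∣ : ∀ Z → ∣ (T ∪ U) ∩ Z ∣ ≡ ∣ T ∩ Z ∣ + ∣ U ∩ Z ∣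
        ∣disjoint-∪∩∣ Z = begin-equality
          ∣ (T ∪ U) ∩ Z ∣                    ≡⟨ +-identityʳ _ ⟨
          ∣ (T ∪ U) ∩ Z ∣ + 0                ≡⟨ cong (∣ (T ∪ U) ∩ Z ∣ +_) (Empty⇒∣p∣≡0 T∩U∩Z≡∅) ⟨
          ∣ (T ∪ U) ∩ Z ∣ + ∣ (T ∩ U) ∩ Z ∣  ≡⟨ ∣p∪q∩r∣+∣p∩q∩r∣≡∣p∩r∣+∣q∩r∣ T U Z ⟩
          ∣ T ∩ Z ∣ + ∣ U ∩ Z ∣              ∎
          where
          T∩U∩Z≡∅ : Empty ((T ∩ U) ∩ Z)
          T∩U∩Z≡∅ (x , x∈T∩U∩Z) = T∩U≡∅ (x , p∩q⊆p (T ∩ U) Z x∈T∩U∩Z)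

        D⊆T∪U : D ⊆ T ∪ U
        D⊆T∪U {x} x∈D with x ∈? T
        ... | yes x∈T = p⊆p∪q U x∈T
        ... | no x∉T = q⊆p∪q T U (covers (x∈p∧x∉q⇒x∈p─q x∈D x∉T))

        T∪U-by-tight : ∀ {x} → x ∈ T ∪ U → ∃ λ S → Tight S × x ∈ S × Nonempty (S ∩ D)
        T∪U-by-tight x∈T∪U with x∈p∪q⁻ T U x∈T∪U
        ... | inj₁ x∈T = T , T-tight , x∈T , e , x∈p∩q⁺ (e∈T , e∈D)
        ... | inj₂ x∈U with by-tight x∈U
        ... | S , S-tight , x∈S , (e′ , e′∈S∩D─T) with x∈p∩q⁻ S (D ─ T) e′∈S∩D─T
        ... | e′∈S , e′∈D─T = S , S-tight , x∈S , e′ , x∈p∩q⁺ (e′∈S , p─q⊆p D T e′∈D─T)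

      tight-cover : ∀ D → D ⊆ Y ─ X → TightCover D
      tight-cover D D⊆Y─X = build D D⊆Y─X (⊂-wellFounded D)
        where
        build : ∀ D → D ⊆ Y ─ X → Acc _⊂_ D → TightCover D
        build D D⊆Y─X (acc smaller) with nonempty? D
        ... | no D≡∅ = empty-cover D≡∅
        ... | yes (e , e∈D) =
          let T , T-greatest = greatest-through (D⊆Y─X e∈D)
              e∈T = proj₂ (proj₁ T-greatest)
          in extend-cover e∈D T-greatest
               (build (D ─ T) (⊆-trans (p─q⊆p D T) D⊆Y─X)
                      (smaller (p∩q≢∅⇒p─q⊂p D T (e , x∈p∩q⁺ (e∈D , e∈T)))))

      tight-through⇒∣Y∣≤∣X∣ : ∣ Y ∣ ≤ ∣ X ∣
      tight-through⇒∣Y∣≤∣X∣ = ∣p∩r∣≤∣q∩r∣⇒∣p∣≤∣q∣ Y X U covers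
        (subst₂ _≤_ (cong ∣_∣ (∩-comm U Y)) (cong ∣_∣ (∩-comm U X)) balanced)
        where open TightCover (tight-cover (Y ─ X) ⊆-refl)

    augment : ∣ X ∣ < ∣ Y ∣ → ∃ λ e → e ∈ Y × e ∉ X × Sparse (⁅ e ⁆ ∪ X)
    augment ∣X∣<∣Y∣ with any? (λ e → (e ∈? Y) ×-dec (¬? (e ∈? X) ×-dec sparse? (⁅ e ⁆ ∪ X)))
    ... | yes extension = extension
    ... | no none = ⊥-elim (<⇒≱ ∣X∣<∣Y∣ (tight-through⇒∣Y∣≤∣X∣ through))
      where
      through : ∀ {e} → e ∈ Y ─ X → ∃ (Through e)
      through {e} e∈Y─X =
        let Z , violation = ¬sparse⇒violation (λ sparse →
              none (e , p─q⊆p Y X e∈Y─X , x∈p─q⇒x∉q Y X e∈Y─X , sparse))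
        in Z , violation⇒through violation

  sparse-isMatroid : IsMatroidIndependence Sparse
  sparse-isMatroid = record
    { empty-indep  = λ Y Y⊆⊥ (_ , x∈Y) → ⊥-elim (∉⊥ (Y⊆⊥ x∈Y))
    ; down-closed  = λ X Y Y⊆X X-sparse Z Z⊆Y → X-sparse Z (⊆-trans Z⊆Y Y⊆X)
    ; augmentation = λ X Y X-sparse Y-sparse → Augmentation.augment X-sparse Y-sparse
    }

anyFin≡true⁺ : ∀ {m} (g : Fin m → Bool) i → g i ≡ true → anyFin g ≡ true
anyFin≡true⁺ g zero    gi≡true rewrite gi≡true = refl
anyFin≡true⁺ g (suc i) gi≡true =
  trans (cong (g zero ∨_) (anyFin≡true⁺ (λ j → g (suc j)) i gi≡true)) (∨-zeroʳ (g zero))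

anyFin≡true⁻ : ∀ {m} (g : Fin m → Bool) → anyFin g ≡ true → ∃ λ i → g i ≡ true
anyFin≡true⁻ {zero}  g ()
anyFin≡true⁻ {suc m} g any≡true with g zero in g0≡true
... | true  = zero , g0≡true
... | false = let i , gi≡true = anyFin≡true⁻ (λ j → g (suc j)) any≡true in suc i , gi≡true

Image : ∀ {m q} → (Fin m → Fin q → Bool) → Subset m → Subset q
Image c Z = tabulate λ v → anyFin λ i → lookup Z i ∧ c i v

module _ {m q} (c : Fin m → Fin q → Bool) where

  ∈Image⁺ : ∀ {Z v} i → i ∈ Z → c i v ≡ true → v ∈ Image c Z
  ∈Image⁺ {Z} {v} i i∈Z civ≡true = lookup⇒[]= v (Image c Z)
    (trans (lookup∘tabulate _ v) (anyFin≡true⁺ _ i (cong₂ _∧_ ([]=⇒lookup i∈Z) civ≡true)))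

  ∈Image⁻ : ∀ {Z v} → v ∈ Image c Z → ∃ λ i → i ∈ Z × c i v ≡ true
  ∈Image⁻ {Z} {v} v∈Image
    with anyFin≡true⁻ _ (trans (sym (lookup∘tabulate _ v)) ([]=⇒lookup v∈Image))
  ... | i , Zi∧civ≡true with lookup Z i in Zi≡true | c i v in civ≡true
  ... | true | true = i , lookup⇒[]= i Z Zi≡true , civ≡true

  Image-mono : ∀ {X Y} → X ⊆ Y → Image c X ⊆ Image c Y
  Image-mono X⊆Y v∈Image with ∈Image⁻ v∈Image
  ... | i , i∈X , civ≡true = ∈Image⁺ i (X⊆Y i∈X) civ≡true

  Image-∪ : ∀ X Y → Image c (X ∪ Y) ⊆ Image c X ∪ Image c Y
  Image-∪ X Y v∈Image with ∈Image⁻ v∈Image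
  ... | i , i∈X∪Y , civ≡true with x∈p∪q⁻ X Y i∈X∪Y
  ... | inj₁ i∈X = p⊆p∪q (Image c Y) (∈Image⁺ i i∈X civ≡true)
  ... | inj₂ i∈Y = q⊆p∪q (Image c X) (Image c Y) (∈Image⁺ i i∈Y civ≡true)

  Image-∩ : ∀ X Y → Image c (X ∩ Y) ⊆ Image c X ∩ Image c Y
  Image-∩ X Y v∈Image with ∈Image⁻ v∈Image
  ... | i , i∈X∩Y , civ≡true with x∈p∩q⁻ X Y i∈X∩Y
  ... | i∈X , i∈Y = x∈p∩q⁺ (∈Image⁺ i i∈X civ≡true , ∈Image⁺ i i∈Y civ≡true)

  ∣Image∣-submodular : ∀ X Y →
    ∣ Image c (X ∪ Y) ∣ + ∣ Image c (X ∩ Y) ∣ ≤ ∣ Image c X ∣ + ∣ Image c Y ∣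
  ∣Image∣-submodular X Y = begin
    ∣ Image c (X ∪ Y) ∣ + ∣ Image c (X ∩ Y) ∣
      ≤⟨ +-mono-≤ (p⊆q⇒∣p∣≤∣q∣ (Image-∪ X Y)) (p⊆q⇒∣p∣≤∣q∣ (Image-∩ X Y)) ⟩
    ∣ Image c X ∪ Image c Y ∣ + ∣ Image c X ∩ Image c Y ∣
      ≡⟨ ∣p∪q∣+∣p∩q∣≡∣p∣+∣q∣ (Image c X) (Image c Y) ⟩
    ∣ Image c X ∣ + ∣ Image c Y ∣ ∎
    where open ≤-Reasoning

lookup⁅y⁆≡false : ∀ {k} {x y : Fin k} → x ≢ y → lookup ⁅ y ⁆ x ≡ false
lookup⁅y⁆≡false x≢y = ¬-not (x≢y⇒x∉⁅y⁆ x≢y ∘ lookup⇒[]= _ _)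

∉Wsingleton : ∀ {p k} {r : Fin k} (w : Vtx p k) → w ≢ inj₂ r → w ∉W singletonR r
∉Wsingleton (inj₁ v)  _   = lookup-replicate v false
∉Wsingleton (inj₂ r′) w≢r = lookup⁅y⁆≡false (w≢r ∘ cong inj₂)

-- A dyperedge with head in R, or a hyperedge inside R, would enter a singleton of R.
meets-V : ∀ {p k} (ε : Edge p k) → WellFormed ε → (∀ r → ¬ Enters ε (singletonR r)) →
          ∃ λ v → incident ε (inj₁ v) ≡ true
meets-V (dyp t (inj₁ v)) _ _ =
  v , trans (cong (lookup (proj₁ t) v ∨_) ([]=⇒lookup (x∈⁅x⁆ v))) (∨-zeroʳ _)
meets-V (dyp t (inj₂ r)) ((w , w∈t) , r∉t) no-entry =
  ⊥-elim (no-entry r ([]=⇒lookup (x∈⁅x⁆ r) , w , w∈t , ∉Wsingleton w w≢r))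
  where
  w≢r : w ≢ inj₂ r
  w≢r refl with () ← trans (sym w∈t) r∉t
meets-V (hyp (A , B)) 2≤∣A∣+∣B∣ no-entry with nonempty? A
... | yes (v , v∈A) = v , []=⇒lookup v∈A
... | no A≡∅ = ⊥-elim (<⇒≱ 1<∣B∣ ∣B∣≤1)
  where
  1<∣B∣ : 1 < ∣ B ∣
  1<∣B∣ = subst (2 ≤_) (cong (_+ ∣ B ∣) (Empty⇒∣p∣≡0 A≡∅)) 2≤∣A∣+∣B∣
  B⊆⁅r⁆ : ∀ {r} → r ∈ B → B ⊆ ⁅ r ⁆
  B⊆⁅r⁆ {r} r∈B {x} x∈B with x ≟ᶠ r
  ... | yes refl = x∈⁅x⁆ r
  ... | no x≢r = ⊥-elim (no-entry r
    ( (inj₂ r , []=⇒lookup r∈B , []=⇒lookup (x∈⁅x⁆ r))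
    , (inj₂ x , []=⇒lookup x∈B , lookup⁅y⁆≡false x≢r)))
  ∣B∣≤1 : ∣ B ∣ ≤ 1
  ∣B∣≤1 with nonempty? B
  ... | yes (r , r∈B) = ≤-trans (p⊆q⇒∣p∣≤∣q∣ (B⊆⁅r⁆ r∈B)) (≤-reflexive (∣⁅x⁆∣≡1 r))
  ... | no B≡∅ = ≤-trans (≤-reflexive (Empty⇒∣p∣≡0 B≡∅)) z≤n

*-∸1-+-mono-≤ : ∀ a {u w x y} → 1 ≤ u → 1 ≤ w → 1 ≤ x → 1 ≤ y → u + w ≤ x + y →
                a * (u ∸ 1) + a * (w ∸ 1) ≤ a * (x ∸ 1) + a * (y ∸ 1)
*-∸1-+-mono-≤ a {suc u} {suc w} {suc x} {suc y} _ _ _ _ u+w≤x+y =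
  subst₂ _≤_ (*-distribˡ-+ a u w) (*-distribˡ-+ a x y)
    (*-monoʳ-≤ a (≤-pred (subst₂ _≤_ (+-suc u w) (+-suc x y) (≤-pred u+w≤x+y))))

module BFunction {p k m} (e : Fin m → Edge p k) (rM : Subset k → ℕ) (rM-rank : IsMatroidRank rM)
  where

  open IsMatroidRank rM-rank

  incidentV : Fin m → Fin p → Bool
  incidentV i v = incident (e i) (inj₁ v)

  incidentR : Fin m → Fin k → Bool
  incidentR i r = isDyp (e i) ∧ incident (e i) (inj₂ r)

  bfun-mono : ∀ {X Y} → X ⊆ Y → bfun e rM X ≤ bfun e rM Y
  bfun-mono X⊆Y =
    +-mono-≤ (*-monoʳ-≤ (rM ⊤) (∸-monoˡ-≤ 1 (p⊆q⇒∣p∣≤∣q∣ (Image-mono incidentV X⊆Y))))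
             (monotone _ _ (Image-mono incidentR X⊆Y))

  bfun-intersecting-submodular : (∀ i → WellFormed (e i)) → (∀ i r → ¬ Enters (e i) (singletonR r)) →
    ∀ X Y → Nonempty (X ∩ Y) → bfun e rM (X ∪ Y) + bfun e rM (X ∩ Y) ≤ bfun e rM X + bfun e rM Y
  bfun-intersecting-submodular well-formed no-entry X Y (i , i∈X∩Y) = begin
    (V (X ∪ Y) + R (X ∪ Y)) + (V (X ∩ Y) + R (X ∩ Y))
      ≡⟨ interchange (V (X ∪ Y)) (R (X ∪ Y)) (V (X ∩ Y)) (R (X ∩ Y)) ⟩
    (V (X ∪ Y) + V (X ∩ Y)) + (R (X ∪ Y) + R (X ∩ Y))
      ≤⟨ +-mono-≤ V-part R-part ⟩
    (V X + V Y) + (R X + R Y)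
      ≡⟨ interchange (V X) (V Y) (R X) (R Y) ⟩
    (V X + R X) + (V Y + R Y) ∎
    where
    open ≤-Reasoning
    V R : Subset m → ℕ
    V Z = rM ⊤ * (∣ Image incidentV Z ∣ ∸ 1)
    R Z = rM (Image incidentR Z)

    1≤∣V∣ : ∀ {Z} → Nonempty Z → 1 ≤ ∣ Image incidentV Z ∣
    1≤∣V∣ (j , j∈Z) =
      let v , v-incident = meets-V (e j) (well-formed j) (no-entry j)
      in x∈p⇒1≤∣p∣ (∈Image⁺ incidentV j j∈Z v-incident)

    i∈X : i ∈ X
    i∈X = p∩q⊆p X Y i∈X∩Y

    i∈Y : i ∈ Y
    i∈Y = p∩q⊆q X Y i∈X∩Y

    V-part : V (X ∪ Y) + V (X ∩ Y) ≤ V X + V Y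
    V-part = *-∸1-+-mono-≤ (rM ⊤) (1≤∣V∣ (i , p⊆p∪q Y i∈X)) (1≤∣V∣ (i , i∈X∩Y))
               (1≤∣V∣ (i , i∈X)) (1≤∣V∣ (i , i∈Y)) (∣Image∣-submodular incidentV X Y)

    R-part : R (X ∪ Y) + R (X ∩ Y) ≤ R X + R Y
    R-part = ≤-trans (+-mono-≤ (monotone _ _ (Image-∪ incidentR X Y))
                               (monotone _ _ (Image-∩ incidentR X Y)))
                     (submodular _ _)

theorem14 : (p k m : ℕ) (e : Fin m → Edge p k) (rM : Subset k → ℕ) →
    (∀ i → WellFormed (e i)) →
    (∀ r → IsSimpleRoot e r) →
    IsMatroidRank rM →
    IsMatroidIndependence (Indep e rM)
theorem14 p k m e rM well-formed roots rM-rank =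
  SparseMatroid.sparse-isMatroid (bfun e rM) bfun-mono
    (bfun-intersecting-submodular well-formed (λ i r → proj₁ (roots r) i))
  where open BFunction e rM rM-rank
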